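{- For $\tau$ in the upper half-plane, \[ \theta_{2,2}(\tau)\theta_{6,0}(\tau)+\theta_{2,0}(\tau)\theta_{6,6}(\tau)= 2\theta_{2,1}(\tau)\theta_{6,3}(\tau), \] \[ \theta_{2,2}(\tau)\theta_{6,4}(\tau)+\theta_{2,0}(\tau)\theta_{6,2}(\tau)= \theta_{2,1}(\tau)\big(\theta_{6,1}(\tau)+\theta_{6,5}(\tau)\big). \]
   Context: $q=e^{2\pi i\tau}$, and for positive integer $m$ and integer $a$, $\theta_{m,a}(\tau):=\sum_{n\in\mathbb Z}q^{\frac{(2mn+a)^2}{4m}}$. -}

module Defs where

open import Data.Nat as ℕ using (ℕ; zero; suc; NonZero; _/_)
open import Data.Nat.Divisibility using (_∣?_)
open import Data.Integer as ℤ using (ℤ; +_; ∣_∣)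
open import Data.List using (List; map; upTo; filter; length)
open import Relation.Nullary using (yes; no)

-- Formal q-series with (non-negative) fractional exponents, represented by
-- their coefficient function: a series "in q^(1/d)" is  j ↦ coefficient of q^(j/d).
Series : Set
Series = ℕ → ℕ

intRange : ℕ → List ℤ
intRange B = map (λ i → + i ℤ.- + B) (upTo (suc (2 ℕ.* B)))

-- θ_{m,a}(τ) = Σ_{n ∈ ℤ} q^((2mn+a)^2/(4m)), as a series in q^(1/(4m)):
-- the coefficient of q^(j/(4m)) is #{ n ∈ ℤ : (2mn+a)^2 = j }.
-- Every such n satisfies |2mn+a| ≤ j, hence |n| ≤ j + |a| (m ≥ 1), so the
-- count over the finite range [-(j+|a|), j+|a|] is the count over all of ℤ.
theta : (m : ℕ) .{{_ : NonZero m}} → ℤ → Series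
theta m a j =
  length (filter (λ n → ((+ (2 ℕ.* m) ℤ.* n ℤ.+ a) ℤ.* (+ (2 ℕ.* m) ℤ.* n ℤ.+ a)) ℤ.≟ + j)
                 (intRange (j ℕ.+ ∣ a ∣)))

-- Re-expand a series in q^(1/d) as a series in q^(1/(k d)).
rescale : (k : ℕ) .{{_ : NonZero k}} → Series → Series
rescale k f j with k ∣? j
... | yes _ = f (j / k)
... | no _  = 0

_⊕_ : Series → Series → Series
(f ⊕ g) j = f j ℕ.+ g j

_·_ : ℕ → Series → Series
(c · f) j = c ℕ.* f j

sumUpTo : ℕ → (ℕ → ℕ) → ℕ
sumUpTo zero    h = h 0
sumUpTo (suc n) h = sumUpTo n h ℕ.+ h (suc n)

_⊛_ : Series → Series → Series
(f ⊛ g) j = sumUpTo j (λ i → f i ℕ.* g (j ℕ.∸ i))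

infixl 6 _⊕_
infixl 7 _⊛_ _·_

-- θ_{2,a} and θ_{6,a} both written as series in q^(1/24).
θ₂ : ℤ → Series
θ₂ a = rescale 3 (theta 2 a)

θ₆ : ℤ → Series
θ₆ a = theta 6 a

-- Comparing coefficients of q^(j/24), the j-th coefficient of θ_{2,a} θ_{6,b} is the number of
-- (n, m) ∈ ℤ² with 3(4n+a)² + (12m+b)² = j, so both identities compare numbers of
-- representations of j by 3x² + y² with x and y in prescribed residue classes.  The reflections
-- (x, y) ↦ ((x ± y)/2, (3x ∓ y)/2) preserve 3x² + y², and, up to sign, they match the residue
-- classes on the two sides once each class is split according to the parity of n ∓ m.  In the
-- coordinates of these pieces every matching is an involution: it swaps the two coordinates,
-- possibly composed with k ↦ -k and k ↦ -k-1.

module Submission where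

open import Defs
open import Data.Bool using (Bool; true; false; not; if_then_else_)
open import Data.Integer as ℤ using (ℤ; +_)
open import Data.List using (List; []; _∷_; map; filter; length; _++_; cartesianProduct)
open import Data.List.Membership.Propositional using (_∈_)
open import Data.List.Relation.Unary.Unique.Propositional using (Unique)
import Data.List.Relation.Unary.Unique.Propositional.Properties as Unique
open import Data.Nat as ℕ using (ℕ)
import Data.Nat.Properties as ℕ
open import Data.Product as Product using (_×_; _,_; proj₁; proj₂; map₁)
open import Data.Sum using (_⊎_; inj₁; inj₂; [_,_]′)
open import Function.Base using (_∘_; id)
open import Function.Bundles using (_↔_; Inverse; mk⇔; mk↔ₛ′)
open import Relation.Binary.PropositionalEquality
open import Relation.Nullary using (Dec; yes; no; does; ¬_; contradiction)
open import Relation.Unary using (Decidable; _≐_)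

-- Counting in lists

module _ where

  open import Algebra.Properties.CommutativeSemigroup ℕ.+-commutativeSemigroup using (interchange)
  open import Data.List.Properties using (length-map; length-++; filter-++; filter-≐; filter-none)
  open import Data.List.Membership.Propositional.Properties
    using (∈-map⁺; ∈-map⁻; ∈-filter⁺; ∈-filter⁻; ∈-++⁺ˡ; ∈-++⁺ʳ)
  open import Data.List.Membership.Propositional.Properties.WithK using (unique∧set⇒bag)
  open import Data.List.Relation.Binary.BagAndSetEquality using (∼bag⇒↭)
  open import Data.List.Relation.Binary.Permutation.Propositional.Properties using (↭-length)
  open import Data.List.Relation.Unary.All using (universal)
  open import Data.Nat using (zero; suc; _+_; _*_; _∸_; _≤_; _<_; z≤n; s≤s⁻¹; _≟_; _≤?_)
  open import Data.Nat.Properties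
  open import Data.Sum.Properties using (inj₁-injective; inj₂-injective)

  count : {A : Set} {P : A → Set} → Decidable P → List A → ℕ
  count P? xs = length (filter P? xs)

  indicator : {P : Set} → Dec P → ℕ
  indicator P? = if does P? then 1 else 0

  indicator-yes : {P : Set} (P? : Dec P) → P → indicator P? ≡ 1
  indicator-yes (yes _) _ = refl
  indicator-yes (no ¬p) p = contradiction p ¬p

  indicator-no : {P : Set} (P? : Dec P) → ¬ P → indicator P? ≡ 0
  indicator-no (yes p) ¬p = contradiction p ¬p
  indicator-no (no _)  _  = refl

  module _ {A : Set} {P : A → Set} (P? : Decidable P) where

    count-∷ : ∀ x xs → count P? (x ∷ xs) ≡ indicator (P? x) + count P? xs
    count-∷ x xs with P? x
    ... | yes _ = refl
    ... | no _  = refl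

    count-++ : ∀ xs ys → count P? (xs ++ ys) ≡ count P? xs + count P? ys
    count-++ xs ys = trans (cong length (filter-++ P? xs ys)) (length-++ (filter P? xs))

    count-map : ∀ {B : Set} (f : B → A) xs → count P? (map f xs) ≡ count (P? ∘ f) xs
    count-map f []       = refl
    count-map f (x ∷ xs) with P? (f x)
    ... | yes _ = cong suc (count-map f xs)
    ... | no _  = count-map f xs

    count-none : (∀ x → ¬ P x) → ∀ xs → count P? xs ≡ 0
    count-none ¬P xs = cong length (filter-none P? (universal ¬P xs))

    count-≐ : ∀ {Q : A → Set} (Q? : Decidable Q) → P ≐ Q → ∀ xs → count P? xs ≡ count Q? xs
    count-≐ Q? P≐Q xs = cong length (filter-≐ P? Q? P≐Q xs)

  module _ {A B : Set} {P : A → Set} {Q : B → Set} (P? : Decidable P) (Q? : Decidable Q) where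

    count-↔ : (e : A ↔ B) → let open Inverse e in
      ∀ {xs ys} → Unique xs → Unique ys → (∀ {x} → P x → x ∈ xs) → (∀ {y} → Q y → y ∈ ys) →
      (∀ {x} → P x → Q (to x)) → (∀ {y} → Q y → P (from y)) →
      count P? xs ≡ count Q? ys
    count-↔ e {xs} {ys} xs! ys! P⊆xs Q⊆ys P⇒Q Q⇒P =
      trans (sym (length-map to (filter P? xs)))
            (↭-length (∼bag⇒↭ (unique∧set⇒bag image! (Unique.filter⁺ Q? ys!) (mk⇔ into onto))))
      where
      open Inverse e
      to-injective : ∀ {x x′} → to x ≡ to x′ → x ≡ x′
      to-injective {x} {x′} eq =
        trans (sym (strictlyInverseʳ x)) (trans (cong from eq) (strictlyInverseʳ x′))
      image! : Unique (map to (filter P? xs))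
      image! = Unique.map⁺ to-injective (Unique.filter⁺ P? xs!)
      into : ∀ {y} → y ∈ map to (filter P? xs) → y ∈ filter Q? ys
      into y∈ with ∈-map⁻ to y∈
      ... | x , x∈ , refl = ∈-filter⁺ Q? (Q⊆ys Qy) Qy
        where
        Qy : Q (to x)
        Qy = P⇒Q (proj₂ (∈-filter⁻ P? {xs = xs} x∈))
      onto : ∀ {y} → y ∈ filter Q? ys → y ∈ map to (filter P? xs)
      onto {y} y∈ = subst (_∈ map to (filter P? xs)) (strictlyInverseˡ y)
                          (∈-map⁺ to (∈-filter⁺ P? (P⊆xs Px) Px))
        where
        Px : P (from y)
        Px = Q⇒P (proj₂ (∈-filter⁻ Q? {xs = ys} y∈))

  module _ {A B : Set} where

    disjointUnion : List A → List B → List (A ⊎ B)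
    disjointUnion xs ys = map inj₁ xs ++ map inj₂ ys

    count-disjointUnion : ∀ {P : A ⊎ B → Set} (P? : Decidable P) xs ys →
      count P? (disjointUnion xs ys) ≡ count (P? ∘ inj₁) xs + count (P? ∘ inj₂) ys
    count-disjointUnion P? xs ys =
      trans (count-++ P? (map inj₁ xs) _) (cong₂ _+_ (count-map P? inj₁ xs) (count-map P? inj₂ ys))

    disjointUnion-unique : ∀ {xs ys} → Unique xs → Unique ys → Unique (disjointUnion xs ys)
    disjointUnion-unique xs! ys! =
      Unique.++⁺ (Unique.map⁺ inj₁-injective xs!) (Unique.map⁺ inj₂-injective ys!) disjoint
      where
      disjoint : ∀ {s} → ¬ (s ∈ map inj₁ _ × s ∈ map inj₂ _)
      disjoint (s∈₁ , s∈₂) with ∈-map⁻ inj₁ s∈₁ | ∈-map⁻ inj₂ s∈₂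
      ... | _ , _ , refl | _ , _ , ()

    ∈-disjointUnion⁺ˡ : ∀ {x xs ys} → x ∈ xs → inj₁ x ∈ disjointUnion xs ys
    ∈-disjointUnion⁺ˡ x∈ = ∈-++⁺ˡ (∈-map⁺ inj₁ x∈)

    ∈-disjointUnion⁺ʳ : ∀ {y xs ys} → y ∈ ys → inj₂ y ∈ disjointUnion xs ys
    ∈-disjointUnion⁺ʳ {xs = xs} y∈ = ∈-++⁺ʳ (map inj₁ xs) (∈-map⁺ inj₂ y∈)

  sumUpTo-cong : ∀ j {f g : ℕ → ℕ} → (∀ {i} → i ≤ j → f i ≡ g i) → sumUpTo j f ≡ sumUpTo j g
  sumUpTo-cong zero    f≗g = f≗g z≤n
  sumUpTo-cong (suc j) f≗g = cong₂ _+_ (sumUpTo-cong j (f≗g ∘ m≤n⇒m≤1+n)) (f≗g ≤-refl)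

  sumUpTo-+ : ∀ j (f g : ℕ → ℕ) → sumUpTo j (λ i → f i + g i) ≡ sumUpTo j f + sumUpTo j g
  sumUpTo-+ zero    f g = refl
  sumUpTo-+ (suc j) f g = trans (cong (_+ (f (suc j) + g (suc j))) (sumUpTo-+ j f g))
                                (interchange (sumUpTo j f) (sumUpTo j g) (f (suc j)) (g (suc j)))

  sumUpTo-0 : ∀ j → sumUpTo j (λ _ → 0) ≡ 0
  sumUpTo-0 zero    = refl
  sumUpTo-0 (suc j) = trans (+-identityʳ _) (sumUpTo-0 j)

  sumUpTo-indicator-> : ∀ {k} j (g : ℕ → ℕ) → j < k → sumUpTo j (λ i → indicator (k ≟ i) * g i) ≡ 0
  sumUpTo-indicator-> zero    g j<k = cong (_* g 0) (indicator-no (_ ≟ 0) (<⇒≢ j<k ∘ sym))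
  sumUpTo-indicator-> (suc j) g j<k = cong₂ _+_
    (sumUpTo-indicator-> j g (<-trans (n<1+n j) j<k))
    (cong (_* g (suc j)) (indicator-no (_ ≟ suc j) (<⇒≢ j<k ∘ sym)))

  sumUpTo-indicator-≤ : ∀ {k} j (g : ℕ → ℕ) → k ≤ j → sumUpTo j (λ i → indicator (k ≟ i) * g i) ≡ g k
  sumUpTo-indicator-≤ zero    g z≤n = +-identityʳ (g 0)
  sumUpTo-indicator-≤ {k} (suc j) g k≤1+j with m≤n⇒m<n∨m≡n k≤1+j
  ... | inj₁ k<1+j = trans (cong₂ _+_ (sumUpTo-indicator-≤ j g (s≤s⁻¹ k<1+j))
                                      (cong (_* g (suc j)) (indicator-no (k ≟ suc j) (<⇒≢ k<1+j))))
                           (+-identityʳ (g k))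
  ... | inj₂ refl  = trans (cong₂ _+_ (sumUpTo-indicator-> j g ≤-refl)
                                      (cong (_* g k) (indicator-yes (k ≟ k) refl)))
                           (+-identityʳ (g k))

  sumUpTo-indicator-count : ∀ {B : Set} (v : B → ℕ) k j ys →
    sumUpTo j (λ i → indicator (k ≟ i) * count (λ y → v y ≟ j ∸ i) ys) ≡ count (λ y → k + v y ≟ j) ys
  sumUpTo-indicator-count v k j ys with k ≤? j
  ... | yes k≤j = trans (sumUpTo-indicator-≤ j _ k≤j)
    (count-≐ _ _ ((λ eq → trans (cong (ℕ._+_ k) eq) (m+[n∸m]≡n k≤j))
                 , (λ eq → trans (sym (m+n∸m≡n k _)) (cong (_∸ k) eq))) ys)
  ... | no k≰j  = trans (sumUpTo-indicator-> j _ (≰⇒> k≰j))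
    (sym (count-none _ (λ y eq → k≰j (m+n≤o⇒m≤o k (≤-reflexive eq))) ys))

  count-convolution : ∀ {A B : Set} (u : A → ℕ) (v : B → ℕ) xs ys j →
    sumUpTo j (λ i → count (λ x → u x ≟ i) xs * count (λ y → v y ≟ j ∸ i) ys)
      ≡ count (λ p → u (proj₁ p) + v (proj₂ p) ≟ j) (cartesianProduct xs ys)
  count-convolution u v []       ys j = sumUpTo-0 j
  count-convolution u v (x ∷ xs) ys j = begin
    sumUpTo j (λ i → count (U i) (x ∷ xs) * c i)
      ≡⟨ sumUpTo-cong j (λ {i} _ → cong (_* c i) (count-∷ (U i) x xs)) ⟩
    sumUpTo j (λ i → (indicator (u x ≟ i) + count (U i) xs) * c i)
      ≡⟨ sumUpTo-cong j (λ {i} _ → *-distribʳ-+ (c i) (indicator (u x ≟ i)) _) ⟩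
    sumUpTo j (λ i → indicator (u x ≟ i) * c i + count (U i) xs * c i)
      ≡⟨ sumUpTo-+ j _ _ ⟩
    sumUpTo j (λ i → indicator (u x ≟ i) * c i) + sumUpTo j (λ i → count (U i) xs * c i)
      ≡⟨ cong₂ _+_ (sumUpTo-indicator-count v (u x) j ys) (count-convolution u v xs ys j) ⟩
    count (λ y → u x + v y ≟ j) ys + count W (cartesianProduct xs ys)
      ≡⟨ cong (_+ count W (cartesianProduct xs ys)) (count-map W (x ,_) ys) ⟨
    count W (map (x ,_) ys) + count W (cartesianProduct xs ys)
      ≡⟨ count-++ W (map (x ,_) ys) _ ⟨
    count W (cartesianProduct (x ∷ xs) ys) ∎
    where
    open ≡-Reasoning
    U : (i : ℕ) → Decidable (λ x → u x ≡ i)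
    U i x = u x ≟ i
    c : ℕ → ℕ
    c i = count (λ y → v y ≟ j ∸ i) ys
    W : Decidable (λ p → u (proj₁ p) + v (proj₂ p) ≡ j)
    W p = u (proj₁ p) + v (proj₂ p) ≟ j

  ⊛-distribˡ-⊕ : ∀ f g h j → (f ⊛ (g ⊕ h)) j ≡ (f ⊛ g ⊕ f ⊛ h) j
  ⊛-distribˡ-⊕ f g h j =
    trans (sumUpTo-cong j (λ {i} _ → *-distribˡ-+ (f i) (g (j ∸ i)) (h (j ∸ i)))) (sumUpTo-+ j _ _)

-- Theta coefficients as representation numbers

module _ where

  open import Data.Integer using (+[1+_]; -[1+_]; ∣_∣)
  import Data.Integer.Properties as ℤ
  open import Data.Integer.Tactic.RingSolver using (solve-∀)
  open import Data.List.Membership.Propositional.Properties using (∈-map⁺; ∈-upTo⁺; ∈-cartesianProduct⁺)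
  open import Data.Nat using (zero; suc; _+_; _*_; _/_; _≤_; z≤n; s≤s; _≟_; NonZero)
  open import Data.Nat.Divisibility using (divides; _∣?_)
  open import Data.Nat.DivMod using (m*n/n≡m)
  open import Data.Nat.Properties
  open import Function.Properties.Inverse using (↔-refl)

  sqr : ℤ → ℕ
  sqr i = ∣ i ∣ * ∣ i ∣

  i*i≡sqr : ∀ i → i ℤ.* i ≡ + sqr i
  i*i≡sqr (+ zero)  = refl
  i*i≡sqr +[1+ n ] = refl
  i*i≡sqr -[1+ n ] = refl

  ∣i∣≤sqr : ∀ i → ∣ i ∣ ≤ sqr i
  ∣i∣≤sqr i with ∣ i ∣
  ... | zero  = z≤n
  ... | suc n = m≤m*n (suc n) (suc n)

  ∣i∣≤sqr[ci+a]+a : ∀ c .{{_ : NonZero c}} i a → ∣ i ∣ ≤ sqr (+ c ℤ.* i ℤ.+ + a) + a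
  ∣i∣≤sqr[ci+a]+a c i a = begin
    ∣ i ∣                              ≤⟨ m≤n*m ∣ i ∣ c ⟩
    c * ∣ i ∣                          ≡⟨ ℤ.abs-* (+ c) i ⟨
    ∣ + c ℤ.* i ∣                      ≡⟨ cong ∣_∣ (sub-add (+ c ℤ.* i) (+ a)) ⟩
    ∣ (+ c ℤ.* i ℤ.+ + a) ℤ.- + a ∣   ≤⟨ ℤ.∣i-j∣≤∣i∣+∣j∣ (+ c ℤ.* i ℤ.+ + a) (+ a) ⟩
    ∣ + c ℤ.* i ℤ.+ + a ∣ + a          ≤⟨ +-monoˡ-≤ a (∣i∣≤sqr (+ c ℤ.* i ℤ.+ + a)) ⟩
    sqr (+ c ℤ.* i ℤ.+ + a) + a        ∎
    where
    open ≤-Reasoning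
    sub-add : ∀ i j → i ≡ (i ℤ.+ j) ℤ.- j
    sub-add = solve-∀

  intRange-unique : ∀ B → Unique (intRange B)
  intRange-unique B = Unique.map⁺ shift-injective (Unique.upTo⁺ _)
    where
    add-sub : ∀ i j → i ≡ (i ℤ.- j) ℤ.+ j
    add-sub = solve-∀
    shift-injective : ∀ {i i′} → + i ℤ.- + B ≡ + i′ ℤ.- + B → i ≡ i′
    shift-injective {i} {i′} eq = ℤ.+-injective
      (trans (add-sub (+ i) (+ B)) (trans (cong (ℤ._+ + B) eq) (sym (add-sub (+ i′) (+ B)))))

  ∈-intRange : ∀ {B i} → ∣ i ∣ ≤ B → i ∈ intRange B
  ∈-intRange {B} {i} ∣i∣≤B = subst (_∈ intRange B) shift-back (∈-map⁺ _ (∈-upTo⁺ (s≤s bound)))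
    where
    nonneg : ∀ j → ∣ j ∣ ≤ B → + ∣ j ℤ.+ + B ∣ ≡ j ℤ.+ + B
    nonneg (+ _)    _     = refl
    nonneg -[1+ _ ] ∣j∣≤B = trans (cong (λ w → + ∣ w ∣) (ℤ.⊖-≥ ∣j∣≤B)) (sym (ℤ.⊖-≥ ∣j∣≤B))
    add-sub : ∀ i j → (i ℤ.+ j) ℤ.- j ≡ i
    add-sub = solve-∀
    shift-back : + ∣ i ℤ.+ + B ∣ ℤ.- + B ≡ i
    shift-back = trans (cong (ℤ._- + B) (nonneg i ∣i∣≤B)) (add-sub i (+ B))
    bound : ∣ i ℤ.+ + B ∣ ≤ 2 * B
    bound = ≤-trans (ℤ.∣i+j∣≤∣i∣+∣j∣ i (+ B))
                    (≤-trans (+-monoˡ-≤ B ∣i∣≤B) (≤-reflexive (cong (ℕ._+_ B) (sym (+-identityʳ B)))))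

  theta≡count : ∀ m .{{_ : NonZero m}} a {k B} → k + a ≤ B →
    theta m (+ a) k ≡ count (λ n → sqr (+ (2 * m) ℤ.* n ℤ.+ + a) ≟ k) (intRange B)
  theta≡count m a {k} {B} k+a≤B =
    count-↔ (λ n → X n ℤ.* X n ℤ.≟ + k) (λ n → sqr (X n) ≟ k) ↔-refl
      (intRange-unique (k + a)) (intRange-unique B)
      (λ {n} eq → ∈-intRange (bound n (from-ℤ n eq)))
      (λ {n} eq → ∈-intRange (≤-trans (bound n eq) k+a≤B))
      (λ {n} → from-ℤ n) (λ {n} eq → trans (i*i≡sqr (X n)) (cong +_ eq))
    where
    X : ℤ → ℤ
    X n = + (2 * m) ℤ.* n ℤ.+ + a
    from-ℤ : ∀ n → X n ℤ.* X n ≡ + k → sqr (X n) ≡ k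
    from-ℤ n eq = ℤ.+-injective (trans (sym (i*i≡sqr (X n))) eq)
    bound : ∀ n → sqr (X n) ≡ k → ∣ n ∣ ≤ k + a
    bound n eq = subst (λ s → ∣ n ∣ ≤ s + a) eq (∣i∣≤sqr[ci+a]+a (2 * m) {{m*n≢0 2 m}} n a)

  -- The exponents of q^(1/24) in the n-th term of θ_{2,a} and in the m-th term of θ_{6,b}.
  exponent₂ : ℕ → ℤ → ℕ
  exponent₂ a n = 3 * sqr (+ 4 ℤ.* n ℤ.+ + a)

  exponent₆ : ℕ → ℤ → ℕ
  exponent₆ b m = sqr (+ 12 ℤ.* m ℤ.+ + b)

  θ₂≡count : ∀ a {i j} → i ≤ j → θ₂ (+ a) i ≡ count (λ n → exponent₂ a n ≟ i) (intRange (j + a))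
  θ₂≡count a {i} {j} i≤j with 3 ∣? i
  -- This case split also reduces the rescale 3 inside θ₂.
  ... | yes (divides q refl) = begin
    theta 2 (+ a) (q * 3 / 3)
      ≡⟨ cong (theta 2 (+ a)) (m*n/n≡m q 3) ⟩
    theta 2 (+ a) q
      ≡⟨ theta≡count 2 a (+-monoˡ-≤ a (≤-trans (m≤m*n q 3) i≤j)) ⟩
    count (λ n → sqr (X n) ≟ q) (intRange (j + a))
      ≡⟨ count-≐ (λ n → sqr (X n) ≟ q) (λ n → exponent₂ a n ≟ q * 3) sqr≡q⇔ (intRange (j + a)) ⟩
    count (λ n → exponent₂ a n ≟ q * 3) (intRange (j + a)) ∎
    where
    open ≡-Reasoning
    X : ℤ → ℤ
    X n = + 4 ℤ.* n ℤ.+ + a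
    sqr≡q⇔ : (λ n → sqr (X n) ≡ q) ≐ (λ n → exponent₂ a n ≡ q * 3)
    sqr≡q⇔ = (λ eq → trans (cong (3 *_) eq) (*-comm 3 q))
           , (λ {n} eq → *-cancelʳ-≡ (sqr (X n)) q 3 (trans (*-comm (sqr (X n)) 3) eq))
  ... | no 3∤i = sym (count-none (λ n → exponent₂ a n ≟ i) exponent≢i (intRange (j + a)))
    where
    exponent≢i : ∀ n → exponent₂ a n ≢ i
    exponent≢i n eq = 3∤i (divides (sqr x) (trans (sym eq) (*-comm 3 (sqr x))))
      where
      x : ℤ
      x = + 4 ℤ.* n ℤ.+ + a

  θ₆≡count : ∀ b {k j} → k ≤ j → θ₆ (+ b) k ≡ count (λ m → exponent₆ b m ≟ k) (intRange (j + b))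
  θ₆≡count b k≤j = theta≡count 6 b (+-monoˡ-≤ b k≤j)

  exponent : ℕ → ℕ → ℤ × ℤ → ℕ
  exponent a b p = exponent₂ a (proj₁ p) + exponent₆ b (proj₂ p)

  box : ℕ → ℕ → ℕ → List (ℤ × ℤ)
  box a b j = cartesianProduct (intRange (j + a)) (intRange (j + b))

  reps : ℕ → ℕ → ℕ → ℕ
  reps a b j = count (λ p → exponent a b p ≟ j) (box a b j)

  θ₂⊛θ₆≡reps : ∀ a b j → (θ₂ (+ a) ⊛ θ₆ (+ b)) j ≡ reps a b j
  θ₂⊛θ₆≡reps a b j = trans
    (sumUpTo-cong j (λ {i} i≤j → cong₂ _*_ (θ₂≡count a i≤j) (θ₆≡count b (m∸n≤m j i))))
    (count-convolution (exponent₂ a) (exponent₆ b) (intRange (j + a)) (intRange (j + b)) j)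

  box-unique : ∀ a b j → Unique (box a b j)
  box-unique a b j = Unique.cartesianProduct⁺ (intRange-unique (j + a)) (intRange-unique (j + b))

  ∈-box : ∀ {a b j} p → exponent a b p ≡ j → p ∈ box a b j
  ∈-box {a} {b} {j} (n , m) eq = ∈-cartesianProduct⁺
    (∈-intRange (≤-trans (∣i∣≤sqr[ci+a]+a 4 n a) (+-monoˡ-≤ a sqr≤j)))
    (∈-intRange (≤-trans (∣i∣≤sqr[ci+a]+a 12 m b)
                         (+-monoˡ-≤ b (≤-trans (m≤n+m (exponent₆ b m) (exponent₂ a n)) (≤-reflexive eq)))))
    where
    sqr≤j : sqr (+ 4 ℤ.* n ℤ.+ + a) ≤ j
    sqr≤j = ≤-trans (m≤n*m _ 3) (≤-trans (m≤m+n (exponent₂ a n) (exponent₆ b m)) (≤-reflexive eq))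

-- Halving integers

module _ where

  open import Data.Integer using (-[1+_]; _+_; _-_)
  open import Data.Integer.Properties using (+-injective)
  open import Data.Integer.Tactic.RingSolver using (solve-∀)
  open import Data.Nat using (zero; suc)

  halveℕ : ℕ → ℕ × Bool
  halveℕ zero          = 0 , false
  halveℕ (suc zero)    = 0 , true
  halveℕ (suc (suc n)) = map₁ suc (halveℕ n)

  halve : ℤ → ℤ × Bool
  halve (+ n)    = map₁ (λ q → + q) (halveℕ n)
  halve -[1+ n ] = Product.map -[1+_] not (halveℕ n)

  unhalve : ℤ × Bool → ℤ
  unhalve (t , false) = t + t
  unhalve (t , true)  = t + t + + 1

  unhalve-halve⁺ : ∀ n → unhalve (halve (+ n)) ≡ + n
  unhalve-halve⁺ zero          = refl
  unhalve-halve⁺ (suc zero)    = refl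
  unhalve-halve⁺ (suc (suc n)) with halveℕ n | unhalve-halve⁺ n
  ... | q , false | q+q≡n   =
    cong (λ w → + suc w) (trans (ℕ.+-suc q q) (cong suc (+-injective q+q≡n)))
  ... | q , true  | q+q+1≡n =
    cong (λ w → + suc w) (trans (cong (ℕ._+ 1) (ℕ.+-suc q q)) (cong suc (+-injective q+q+1≡n)))

  unhalve-halve : ∀ i → unhalve (halve i) ≡ i
  unhalve-halve (+ n) = unhalve-halve⁺ n
  unhalve-halve -[1+ n ] with halveℕ n | unhalve-halve⁺ n
  ... | q , false | q+q≡n   = cong -[1+_] (+-injective q+q≡n)
  ... | q , true  | q+q+1≡n = cong -[1+_] (trans (ℕ.+-comm 1 (q ℕ.+ q)) (+-injective q+q+1≡n))

  halveℕ-double : ∀ k → halveℕ (k ℕ.+ k) ≡ (k , false)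
  halveℕ-double zero    = refl
  halveℕ-double (suc k) rewrite ℕ.+-suc k k = cong (map₁ suc) (halveℕ-double k)

  halveℕ-double+1 : ∀ k → halveℕ (suc (k ℕ.+ k)) ≡ (k , true)
  halveℕ-double+1 zero    = refl
  halveℕ-double+1 (suc k) rewrite ℕ.+-suc k k = cong (map₁ suc) (halveℕ-double+1 k)

  halve-unhalve : ∀ p → halve (unhalve p) ≡ p
  halve-unhalve (+ k , false)      = cong (map₁ (λ q → + q)) (halveℕ-double k)
  halve-unhalve (+ k , true)       =
    cong (map₁ (λ q → + q)) (trans (cong halveℕ (ℕ.+-comm (k ℕ.+ k) 1)) (halveℕ-double+1 k))
  halve-unhalve (-[1+ k ] , false) = cong (Product.map -[1+_] not) (halveℕ-double+1 k)
  halve-unhalve (-[1+ k ] , true)  = cong (Product.map -[1+_] not) (halveℕ-double k)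

  parity-split : (ℤ → ℤ) → (ℤ × ℤ) ↔ ((ℤ × ℤ) × Bool)
  parity-split h = mk↔ₛ′ split unsplit split-unsplit unsplit-split
    where
    split : ℤ × ℤ → (ℤ × ℤ) × Bool
    split (n , m) = let (t , b) = halve (n - h m) in (m , t) , b
    unsplit : (ℤ × ℤ) × Bool → ℤ × ℤ
    unsplit ((k , t) , b) = unhalve (t , b) + h k , k
    add-sub : ∀ i j → i + j - j ≡ i
    add-sub = solve-∀
    sub-add : ∀ i j → i - j + j ≡ i
    sub-add = solve-∀
    split-unsplit : ∀ p → split (unsplit p) ≡ p
    split-unsplit ((k , t) , b) = cong (λ (t , b) → (k , t) , b)
      (trans (cong halve (add-sub (unhalve (t , b)) (h k))) (halve-unhalve (t , b)))
    unsplit-split : ∀ p → unsplit (split p) ≡ p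
    unsplit-split (n , m) = cong (_, m) (trans (cong (_+ h m) (unhalve-halve (n - h m))) (sub-add n (h m)))

-- Exchanging the pieces of two residue classes

module _ where

  open import Data.Integer using (-_; _+_; _-_; _*_)
  open import Data.Integer.Properties using (+-injective; pos-+; pos-*; neg-involutive)
  open import Data.Integer.Tactic.RingSolver using (solve)
  open import Data.Nat using (_≟_)
  open import Data.Sum.Function.Propositional using (_⊎-↔_)
  open import Function.Base using (_∋_)
  open import Function.Properties.Inverse using (↔-trans; ↔-sym)

  value : ℕ → ℕ → ℤ × ℤ → ℤ
  value a b (n , m) = + 3 * ((+ 4 * n + + a) * (+ 4 * n + + a)) + (+ 12 * m + + b) * (+ 12 * m + + b)

  +exponent≡value : ∀ a b p → + exponent a b p ≡ value a b p
  +exponent≡value a b (n , m) = begin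
    + (3 ℕ.* sqr x ℕ.+ sqr y)   ≡⟨ pos-+ (3 ℕ.* sqr x) (sqr y) ⟩
    + (3 ℕ.* sqr x) + + sqr y   ≡⟨ cong (_+ + sqr y) (pos-* 3 (sqr x)) ⟩
    + 3 * + sqr x + + sqr y     ≡⟨ cong₂ (λ u v → + 3 * u + v) (i*i≡sqr x) (i*i≡sqr y) ⟨
    value a b (n , m)           ∎
    where
    open ≡-Reasoning
    x y : ℤ
    x = + 4 * n + + a
    y = + 12 * m + + b

  -- value a b p ≡ value a′ b′ p′ with value unfolded, so that the reflective ring solver sees polynomials.
  SameExponent : ℕ → ℕ → ℤ × ℤ → ℕ → ℕ → ℤ × ℤ → Set
  SameExponent a b (n , m) a′ b′ (n′ , m′) =
    + 3 * ((+ 4 * n + + a) * (+ 4 * n + + a)) + (+ 12 * m + + b) * (+ 12 * m + + b)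
      ≡ + 3 * ((+ 4 * n′ + + a′) * (+ 4 * n′ + + a′)) + (+ 12 * m′ + + b′) * (+ 12 * m′ + + b′)

  same-exponent : ∀ a b p a′ b′ p′ → SameExponent a b p a′ b′ p′ → exponent a b p ≡ exponent a′ b′ p′
  same-exponent a b p@(_ , _) a′ b′ p′@(_ , _) eq =
    +-injective (trans (+exponent≡value a b p) (trans eq (sym (+exponent≡value a′ b′ p′))))

  Pieces : Set
  Pieces = ((ℤ × ℤ) × Bool) ⊎ ((ℤ × ℤ) × Bool)

  parity-split⊎ : (ℤ → ℤ) → ((ℤ × ℤ) ⊎ (ℤ × ℤ)) ↔ Pieces
  parity-split⊎ h = parity-split h ⊎-↔ parity-split h

  unsplit : (ℤ → ℤ) → Pieces → (ℤ × ℤ) ⊎ (ℤ × ℤ)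
  unsplit h = Inverse.from (parity-split⊎ h)

  exponent⊎ : ℕ → ℕ → ℕ → ℕ → (ℤ × ℤ) ⊎ (ℤ × ℤ) → ℕ
  exponent⊎ a b a′ b′ = [ exponent a b , exponent a′ b′ ]′

  ∈-boxes : ∀ {a b a′ b′ j} s → exponent⊎ a b a′ b′ s ≡ j → s ∈ disjointUnion (box a b j) (box a′ b′ j)
  ∈-boxes (inj₁ p) eq = ∈-disjointUnion⁺ˡ (∈-box p eq)
  ∈-boxes {a} {b} {j = j} (inj₂ p) eq = ∈-disjointUnion⁺ʳ {xs = box a b j} (∈-box p eq)

  reps-+-transfer : ∀ {a b a′ b′ c d c′ d′} h (L : Pieces ↔ Pieces) →
    (∀ p → exponent⊎ c d c′ d′ (unsplit h (Inverse.to L p)) ≡ exponent⊎ a b a′ b′ (unsplit h p)) →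
    ∀ j → reps a b j ℕ.+ reps a′ b′ j ≡ reps c d j ℕ.+ reps c′ d′ j
  reps-+-transfer {a} {b} {a′} {b′} {c} {d} {c′} {d′} h L L-preserves j = begin
    reps a b j ℕ.+ reps a′ b′ j  ≡⟨ count-disjointUnion P? (box a b j) (box a′ b′ j) ⟨
    count P? source              ≡⟨ count-↔ P? Q? e
                                      (disjointUnion-unique (box-unique a b j) (box-unique a′ b′ j))
                                      (disjointUnion-unique (box-unique c d j) (box-unique c′ d′ j))
                                      (∈-boxes _) (∈-boxes _) (λ {s} → P⇒Q {s}) (λ {s} → Q⇒P {s}) ⟩
    count Q? target              ≡⟨ count-disjointUnion Q? (box c d j) (box c′ d′ j) ⟩
    reps c d j ℕ.+ reps c′ d′ j  ∎
    where
    open ≡-Reasoning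
    S : ((ℤ × ℤ) ⊎ (ℤ × ℤ)) ↔ Pieces
    S = parity-split⊎ h
    open Inverse S using () renaming (to to split; strictlyInverseʳ to unsplit-split)
    e : ((ℤ × ℤ) ⊎ (ℤ × ℤ)) ↔ ((ℤ × ℤ) ⊎ (ℤ × ℤ))
    e = ↔-trans S (↔-trans L (↔-sym S))
    P? : Decidable (λ s → exponent⊎ a b a′ b′ s ≡ j)
    P? s = exponent⊎ a b a′ b′ s ≟ j
    Q? : Decidable (λ s → exponent⊎ c d c′ d′ s ≡ j)
    Q? s = exponent⊎ c d c′ d′ s ≟ j
    source target : List ((ℤ × ℤ) ⊎ (ℤ × ℤ))
    source = disjointUnion (box a b j) (box a′ b′ j)
    target = disjointUnion (box c d j) (box c′ d′ j)
    P⇒Q : ∀ {s} → exponent⊎ a b a′ b′ s ≡ j → exponent⊎ c d c′ d′ (Inverse.to e s) ≡ j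
    P⇒Q {s} eq = trans (L-preserves (split s)) (trans (cong (exponent⊎ a b a′ b′) (unsplit-split s)) eq)
    Q⇒P : ∀ {s} → exponent⊎ c d c′ d′ s ≡ j → exponent⊎ a b a′ b′ (Inverse.from e s) ≡ j
    Q⇒P {s} eq = trans (sym (L-preserves (Inverse.from L (split s))))
      (trans (cong (exponent⊎ c d c′ d′ ∘ unsplit h) (Inverse.strictlyInverseˡ L (split s)))
             (trans (cong (exponent⊎ c d c′ d′) (unsplit-split s)) eq))

  mirror : ℤ → ℤ
  mirror i = - i - + 1

  mirror-involutive : ∀ i → mirror (mirror i) ≡ i
  mirror-involutive i = - (- i - + 1) - + 1 ≡ i ∋ solve (i ∷ [])

  exchange₁ : Pieces → Pieces
  exchange₁ (inj₁ ((k , t) , false)) = inj₁ ((t , k) , false)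
  exchange₁ (inj₁ ((k , t) , true))  = inj₂ ((mirror t , - k) , false)
  exchange₁ (inj₂ ((k , t) , false)) = inj₁ ((- t , mirror k) , true)
  exchange₁ (inj₂ ((k , t) , true))  = inj₂ ((t , k) , true)

  exchange₁-involutive : ∀ p → exchange₁ (exchange₁ p) ≡ p
  exchange₁-involutive (inj₁ ((k , t) , false)) = refl
  exchange₁-involutive (inj₁ ((k , t) , true))  =
    cong (λ q → inj₁ (q , true)) (cong₂ _,_ (neg-involutive k) (mirror-involutive t))
  exchange₁-involutive (inj₂ ((k , t) , false)) =
    cong (λ q → inj₂ (q , false)) (cong₂ _,_ (mirror-involutive k) (neg-involutive t))
  exchange₁-involutive (inj₂ ((k , t) , true))  = refl

  exchange₁-exponent : ∀ p →
    exponent⊎ 2 0 0 6 (unsplit id (exchange₁ p)) ≡ exponent⊎ 1 3 1 3 (unsplit id p)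
  exchange₁-exponent (inj₁ ((k , t) , false)) =
    same-exponent 2 0 (k + k + t , t) 1 3 (t + t + k , k) (solve (k ∷ t ∷ []))
  exchange₁-exponent (inj₁ ((k , t) , true))  =
    same-exponent 0 6 (- k + - k + (- t - + 1) , - t - + 1) 1 3 (t + t + + 1 + k , k) (solve (k ∷ t ∷ []))
  exchange₁-exponent (inj₂ ((k , t) , false)) =
    same-exponent 2 0 ((- k - + 1) + (- k - + 1) + + 1 + - t , - t) 1 3 (t + t + k , k) (solve (k ∷ t ∷ []))
  exchange₁-exponent (inj₂ ((k , t) , true))  =
    same-exponent 0 6 (k + k + + 1 + t , t) 1 3 (t + t + + 1 + k , k) (solve (k ∷ t ∷ []))

  reps-exchange₁ : ∀ j → reps 1 3 j ℕ.+ reps 1 3 j ≡ reps 2 0 j ℕ.+ reps 0 6 j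
  reps-exchange₁ = reps-+-transfer id
    (mk↔ₛ′ exchange₁ exchange₁ exchange₁-involutive exchange₁-involutive) exchange₁-exponent

  exchange₂ : Pieces → Pieces
  exchange₂ (inj₁ ((k , t) , false)) = inj₂ ((t , k) , false)
  exchange₂ (inj₁ ((k , t) , true))  = inj₁ ((mirror t , mirror k) , true)
  exchange₂ (inj₂ ((k , t) , false)) = inj₁ ((t , k) , false)
  exchange₂ (inj₂ ((k , t) , true))  = inj₂ ((mirror t , mirror k) , true)

  exchange₂-involutive : ∀ p → exchange₂ (exchange₂ p) ≡ p
  exchange₂-involutive (inj₁ ((k , t) , false)) = refl
  exchange₂-involutive (inj₁ ((k , t) , true))  =
    cong (λ q → inj₁ (q , true)) (cong₂ _,_ (mirror-involutive k) (mirror-involutive t))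
  exchange₂-involutive (inj₂ ((k , t) , false)) = refl
  exchange₂-involutive (inj₂ ((k , t) , true))  =
    cong (λ q → inj₂ (q , true)) (cong₂ _,_ (mirror-involutive k) (mirror-involutive t))

  exchange₂-exponent : ∀ p →
    exponent⊎ 2 4 0 2 (unsplit -_ (exchange₂ p)) ≡ exponent⊎ 1 1 1 5 (unsplit -_ p)
  exchange₂-exponent (inj₁ ((k , t) , false)) =
    same-exponent 0 2 (k + k + - t , t) 1 1 (t + t + - k , k) (solve (k ∷ t ∷ []))
  exchange₂-exponent (inj₁ ((k , t) , true))  =
    same-exponent 2 4 ((- k - + 1) + (- k - + 1) + + 1 + - (- t - + 1) , - t - + 1) 1 1 (t + t + + 1 + - k , k)
      (solve (k ∷ t ∷ []))
  exchange₂-exponent (inj₂ ((k , t) , false)) =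
    same-exponent 2 4 (k + k + - t , t) 1 5 (t + t + - k , k) (solve (k ∷ t ∷ []))
  exchange₂-exponent (inj₂ ((k , t) , true))  =
    same-exponent 0 2 ((- k - + 1) + (- k - + 1) + + 1 + - (- t - + 1) , - t - + 1) 1 5 (t + t + + 1 + - k , k)
      (solve (k ∷ t ∷ []))

  reps-exchange₂ : ∀ j → reps 1 1 j ℕ.+ reps 1 5 j ≡ reps 2 4 j ℕ.+ reps 0 2 j
  reps-exchange₂ = reps-+-transfer -_
    (mk↔ₛ′ exchange₂ exchange₂ exchange₂-involutive exchange₂-involutive) exchange₂-exponent

lemma4p2 : (∀ j → (θ₂ (+ 2) ⊛ θ₆ (+ 0) ⊕ θ₂ (+ 0) ⊛ θ₆ (+ 6)) j ≡ (2 · (θ₂ (+ 1) ⊛ θ₆ (+ 3))) j)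
    × (∀ j → (θ₂ (+ 2) ⊛ θ₆ (+ 4) ⊕ θ₂ (+ 0) ⊛ θ₆ (+ 2)) j ≡ (θ₂ (+ 1) ⊛ (θ₆ (+ 1) ⊕ θ₆ (+ 5))) j)
lemma4p2 = first , second
  where
  open ≡-Reasoning
  first : ∀ j → (θ₂ (+ 2) ⊛ θ₆ (+ 0) ⊕ θ₂ (+ 0) ⊛ θ₆ (+ 6)) j ≡ (2 · (θ₂ (+ 1) ⊛ θ₆ (+ 3))) j
  first j = begin
    (θ₂ (+ 2) ⊛ θ₆ (+ 0) ⊕ θ₂ (+ 0) ⊛ θ₆ (+ 6)) j
      ≡⟨ cong₂ ℕ._+_ (θ₂⊛θ₆≡reps 2 0 j) (θ₂⊛θ₆≡reps 0 6 j) ⟩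
    reps 2 0 j ℕ.+ reps 0 6 j
      ≡⟨ reps-exchange₁ j ⟨
    reps 1 3 j ℕ.+ reps 1 3 j
      ≡⟨ cong (reps 1 3 j ℕ.+_) (ℕ.+-identityʳ (reps 1 3 j)) ⟨
    2 ℕ.* reps 1 3 j
      ≡⟨ cong (2 ℕ.*_) (θ₂⊛θ₆≡reps 1 3 j) ⟨
    (2 · (θ₂ (+ 1) ⊛ θ₆ (+ 3))) j ∎
  second : ∀ j → (θ₂ (+ 2) ⊛ θ₆ (+ 4) ⊕ θ₂ (+ 0) ⊛ θ₆ (+ 2)) j ≡ (θ₂ (+ 1) ⊛ (θ₆ (+ 1) ⊕ θ₆ (+ 5))) j
  second j = begin
    (θ₂ (+ 2) ⊛ θ₆ (+ 4) ⊕ θ₂ (+ 0) ⊛ θ₆ (+ 2)) j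
      ≡⟨ cong₂ ℕ._+_ (θ₂⊛θ₆≡reps 2 4 j) (θ₂⊛θ₆≡reps 0 2 j) ⟩
    reps 2 4 j ℕ.+ reps 0 2 j
      ≡⟨ reps-exchange₂ j ⟨
    reps 1 1 j ℕ.+ reps 1 5 j
      ≡⟨ cong₂ ℕ._+_ (θ₂⊛θ₆≡reps 1 1 j) (θ₂⊛θ₆≡reps 1 5 j) ⟨
    (θ₂ (+ 1) ⊛ θ₆ (+ 1) ⊕ θ₂ (+ 1) ⊛ θ₆ (+ 5)) j
      ≡⟨ ⊛-distribˡ-⊕ (θ₂ (+ 1)) (θ₆ (+ 1)) (θ₆ (+ 5)) j ⟨
    (θ₂ (+ 1) ⊛ (θ₆ (+ 1) ⊕ θ₆ (+ 5))) j ∎
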